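{- Let $\Sigma$ be a finite alphabet. A language $L \subseteq \Sigma^*$ is LIKE-characterizable if and only if $L \in B_2$, i.e. if and only if $L$ has dot-depth at most $1$.
   Context: A LIKE pattern over $\Sigma$ is a finite string over $\Sigma \cup \{\%, \_\}$, where $\%$ and $\_$ are wildcard symbols not in $\Sigma$. Its language is obtained by interpreting each letter of $\Sigma$ as itself, each $\_$ as $\Sigma$ (any single character), each $\%$ as $\Sigma^*$ (any string, possibly empty), and juxtaposition as concatenation; a string $t \in \Sigma^*$ matches the pattern if $t$ (as a whole) belongs to this language. A language $L \subseteq \Sigma^*$ is LIKE-characterizable if it is the set of strings satisfying some boolean combination (using AND, OR, NOT) of conditions "$t$ matches $p$" for LIKE patterns $p$. Dot-depth hierarchy (Cohen–Brzozowski): $E_0$ consists of the languages $\{a\}$ for $a \in \Sigma$ and $\{\varepsilon\}$; for a family $X$ of languages, $B(X)$ is its closure under boolean operations (relative to $\Sigma^*$) and $M(X)$ its closure under concatenation; $B_1 = B(E_0)$, $M_n = M(B_n)$ for $n \ge 1$, $B_n = B(M_{n-1})$ for $n \ge 2$. A language $R$ has dot-depth $n$ if $R \in B_{n+1} \setminus B_n$. -}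

module Defs where

open import Level using (Level; 0ℓ) renaming (suc to lsuc)
open import Data.Nat using (ℕ; zero; suc)
open import Data.Fin using (Fin)
open import Data.List using (List; []; _∷_; _++_)
open import Data.Product using (Σ; ∃; _×_; _,_)
open import Data.Sum using (_⊎_)
open import Data.Unit using (⊤)
open import Relation.Nullary using (¬_)
open import Relation.Binary.PropositionalEquality using (_≡_)
open import Function.Bundles using (_⇔_)

-- The finite alphabet Σ is Fin n (any finite alphabet is in bijection with some Fin n).
-- A language over Fin n is a predicate on words (strings) List (Fin n).
Lang : ℕ → Set₁
Lang n = List (Fin n) → Set

module _ {n : ℕ} where

  _·_ : Lang n → Lang n → Lang n
  (L · K) t = Σ (List (Fin n)) λ u → Σ (List (Fin n)) λ v → (t ≡ u ++ v) × L u × K v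

  data BoolClosure (X : Lang n → Set₁) : Lang n → Set₁ where
    base  : ∀ {L} → X L → BoolClosure X L
    compl : ∀ {L} → BoolClosure X L → BoolClosure X (λ t → ¬ L t)
    union : ∀ {L K} → BoolClosure X L → BoolClosure X K → BoolClosure X (λ t → L t ⊎ K t)
    inter : ∀ {L K} → BoolClosure X L → BoolClosure X K → BoolClosure X (λ t → L t × K t)
    ext   : ∀ {L K} → BoolClosure X L → (∀ t → L t ⇔ K t) → BoolClosure X K

  data ConcatClosure (X : Lang n → Set₁) : Lang n → Set₁ where
    base   : ∀ {L} → X L → ConcatClosure X L
    concat : ∀ {L K} → ConcatClosure X L → ConcatClosure X K → ConcatClosure X (L · K)
    ext    : ∀ {L K} → ConcatClosure X L → (∀ t → L t ⇔ K t) → ConcatClosure X K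

  data E₀ : Lang n → Set₁ where
    letter : (a : Fin n) → E₀ (λ t → t ≡ a ∷ [])
    empty  : E₀ (λ t → t ≡ [])

  -- Dot-depth hierarchy, shifted: Bsuc k = B_{k+1}.
  -- B₁ = B(E₀), M_k = M(B_k), B_{k+1} = B(M_k).
  Bsuc : ℕ → Lang n → Set₁
  Bsuc zero    = BoolClosure E₀
  Bsuc (suc k) = BoolClosure (ConcatClosure (Bsuc k))

  B₂ : Lang n → Set₁
  B₂ = Bsuc 1

  data Sym : Set where
    lit  : Fin n → Sym
    one  : Sym   -- '_'
    many : Sym   -- '%'

  Pattern : Set
  Pattern = List Sym

  symLang : Sym → Lang n
  symLang (lit a) t = t ≡ a ∷ []
  symLang one     t = Σ (Fin n) λ a → t ≡ a ∷ []
  symLang many    t = ⊤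

  patLang : Pattern → Lang n
  patLang []      t = t ≡ []
  patLang (s ∷ p)   = symLang s · patLang p

  Matches : List (Fin n) → Pattern → Set
  Matches t p = patLang p t

  data PatternCondition : Lang n → Set₁ where
    pat : (p : Pattern) → PatternCondition (λ t → Matches t p)

  LIKECharacterizable : Lang n → Set₁
  LIKECharacterizable = BoolClosure PatternCondition

-- A word pattern is a concatenation of B₁ languages, so LIKE ⊆ B₂ is immediate.
-- Conversely, membership in a B₁ language depends only on the shape of a word
-- (empty, a single letter a, or of length at least 2), and each shape is the
-- language of a pattern (ε, a, __%).  Hence every B₁ language is a finite union of
-- patterns; such unions are closed under concatenation because patterns are, so every
-- language of M₁ is a finite union of patterns, and B₂ = B(M₁) ⊆ LIKE.
module Submission where

open import Defs
open import Level using (0ℓ)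
open import Data.Nat using (ℕ)
open import Data.Fin using (Fin)
open import Data.Fin.Properties using (_≟_)
open import Data.List using (List; []; _∷_; _++_; map; allFin; filter; cartesianProductWith)
open import Data.List.Properties using (++-assoc; ++-identityʳ)
open import Data.List.Relation.Unary.Any as Any using (Any; here; there; satisfied; toSum; fromSum)
open import Data.List.Relation.Unary.Any.Properties using (++⁺ˡ; ++⁺ʳ; ++⁻; map⁺; map⁻)
open import Data.List.Membership.Propositional using (_∈_; lose)
open import Data.List.Membership.Propositional.Properties using (∈-map⁺; ∈-allFin; ∈-filter⁺; ∈-filter⁻)
open import Data.Product using (∃; _×_; _,_; proj₂)
open import Data.Product.Function.NonDependent.Propositional using (_×-⇔_)
open import Data.Sum using (_⊎_; inj₁; inj₂)
open import Data.Sum.Function.Propositional using (_⊎-⇔_)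
open import Data.Unit using (tt)
open import Data.Empty using (⊥; ⊥-elim)
open import Function.Base using (_∘_)
open import Function.Bundles using (_⇔_; mk⇔; Equivalence)
import Function.Properties.Equivalence as ⇔
open import Function.Related.TypeIsomorphisms using (¬-cong-⇔)
open import Relation.Nullary using (¬_; Dec; yes; no)
open import Relation.Nullary.Decidable using (¬?; _⊎-dec_; _×-dec_)
import Relation.Nullary.Decidable as Dec
open import Relation.Binary.Definitions using (DecidableEquality)
open import Relation.Binary.PropositionalEquality using (_≡_; refl; sym; trans; cong; subst)
open import Relation.Binary.Reasoning.Setoid (⇔.⇔-setoid 0ℓ)

open Equivalence using (to; from)

Any-⇔ : {A : Set} {P Q : A → Set} → (∀ x → P x ⇔ Q x) → ∀ {xs} → Any P xs ⇔ Any Q xs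
Any-⇔ P⇔Q = mk⇔ (Any.map (to (P⇔Q _))) (Any.map (from (P⇔Q _)))

Any-cartesianProductWith : {A B C : Set} (f : A → B → C) {R : C → Set} (xs : List A) (ys : List B) →
                           Any R (cartesianProductWith f xs ys) ⇔ Any (λ x → Any (λ y → R (f x y)) ys) xs
Any-cartesianProductWith f {R} xs ys = mk⇔ (split xs) (join xs)
  where
  split : ∀ xs → Any R (cartesianProductWith f xs ys) → Any (λ x → Any (λ y → R (f x y)) ys) xs
  split (x ∷ xs) r with ++⁻ (map (f x) ys) r
  ... | inj₁ r = here (map⁻ r)
  ... | inj₂ r = there (split xs r)
  join : ∀ xs → Any (λ x → Any (λ y → R (f x y)) ys) xs → Any R (cartesianProductWith f xs ys)
  join (x ∷ xs) (here r)  = ++⁺ˡ (map⁺ r)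
  join (x ∷ xs) (there r) = ++⁺ʳ (map (f x) ys) (join xs r)

module _ {n : ℕ} where

  private
    Word : Set
    Word = List (Fin n)

  BoolClosure-bind : {X Y : Lang n → Set₁} → (∀ {L} → X L → BoolClosure Y L) →
                     ∀ {L} → BoolClosure X L → BoolClosure Y L
  BoolClosure-bind h (base x)    = h x
  BoolClosure-bind h (compl b)   = compl (BoolClosure-bind h b)
  BoolClosure-bind h (union a b) = union (BoolClosure-bind h a) (BoolClosure-bind h b)
  BoolClosure-bind h (inter a b) = inter (BoolClosure-bind h a) (BoolClosure-bind h b)
  BoolClosure-bind h (ext b e)   = ext (BoolClosure-bind h b) e

  BoolClosure-∅ : {X : Lang n → Set₁} {L : Lang n} → BoolClosure X L → BoolClosure X (λ _ → ⊥)
  BoolClosure-∅ b = ext (inter b (compl b)) (λ _ → mk⇔ (λ (x , ¬x) → ¬x x) ⊥-elim)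

  BoolClosure-Any : {X : Lang n → Set₁} {A : Set} {P : A → Lang n} →
                    BoolClosure X (λ _ → ⊥) → (∀ x → BoolClosure X (P x)) →
                    ∀ xs → BoolClosure X (λ t → Any (λ x → P x t) xs)
  BoolClosure-Any ∅ b []       = ext ∅ (λ _ → mk⇔ ⊥-elim (λ ()))
  BoolClosure-Any ∅ b (x ∷ xs) = ext (union (b x) (BoolClosure-Any ∅ b xs)) (λ _ → mk⇔ fromSum toSum)

  ·-cong : {L L′ K K′ : Lang n} → (∀ u → L u ⇔ L′ u) → (∀ v → K v ⇔ K′ v) →
           ∀ t → (L · K) t ⇔ (L′ · K′) t
  ·-cong L⇔L′ K⇔K′ t =
    mk⇔ (λ (u , v , e , x , y) → u , v , e , to (L⇔L′ u) x , to (K⇔K′ v) y)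
        (λ (u , v , e , x , y) → u , v , e , from (L⇔L′ u) x , from (K⇔K′ v) y)

  ·-assoc : (L K M : Lang n) → ∀ t → ((L · K) · M) t ⇔ (L · (K · M)) t
  ·-assoc L K M t = mk⇔
    (λ (_ , v₂ , e , (u , v₁ , e₁ , x , y) , z) →
       u , v₁ ++ v₂ , trans e (trans (cong (_++ v₂) e₁) (++-assoc u v₁ v₂)) , x , (v₁ , v₂ , refl , y , z))
    (λ (u , _ , e , x , (v₁ , v₂ , e₂ , y , z)) →
       u ++ v₁ , v₂ , trans e (trans (cong (u ++_) e₂) (sym (++-assoc u v₁ v₂))) , (u , v₁ , refl , x , y) , z)

  ε·-identity : (K : Lang n) → ∀ t → ((λ u → u ≡ []) · K) t ⇔ K t
  ε·-identity K t = mk⇔ (λ { (.[] , v , e , refl , y) → subst K (sym e) y })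
                        (λ y → [] , t , refl , refl , y)

  ·-Anyˡ : {A : Set} (L : A → Lang n) (K : Lang n) (xs : List A) →
           ∀ t → Any (λ x → (L x · K) t) xs ⇔ ((λ u → Any (λ x → L x u) xs) · K) t
  ·-Anyˡ L K xs t = mk⇔ (outward xs) (inward xs)
    where
    outward : ∀ xs → Any (λ x → (L x · K) t) xs → ((λ u → Any (λ x → L x u) xs) · K) t
    outward (x ∷ xs) (here (u , v , e , p , q)) = u , v , e , here p , q
    outward (x ∷ xs) (there r) with outward xs r
    ... | u , v , e , p , q = u , v , e , there p , q
    inward : ∀ xs → ((λ u → Any (λ x → L x u) xs) · K) t → Any (λ x → (L x · K) t) xs
    inward (x ∷ xs) (u , v , e , here p , q)  = here (u , v , e , p , q)
    inward (x ∷ xs) (u , v , e , there p , q) = there (inward xs (u , v , e , p , q))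

  ·-Anyʳ : {A : Set} (L : Lang n) (K : A → Lang n) (ys : List A) →
           ∀ t → Any (λ y → (L · K y) t) ys ⇔ (L · (λ v → Any (λ y → K y v) ys)) t
  ·-Anyʳ L K ys t = mk⇔ (outward ys) (inward ys)
    where
    outward : ∀ ys → Any (λ y → (L · K y) t) ys → (L · (λ v → Any (λ y → K y v) ys)) t
    outward (y ∷ ys) (here (u , v , e , p , q)) = u , v , e , p , here q
    outward (y ∷ ys) (there r) with outward ys r
    ... | u , v , e , p , q = u , v , e , p , there q
    inward : ∀ ys → (L · (λ v → Any (λ y → K y v) ys)) t → Any (λ y → (L · K y) t) ys
    inward (y ∷ ys) (u , v , e , p , here q)  = here (u , v , e , p , q)
    inward (y ∷ ys) (u , v , e , p , there q) = there (inward ys (u , v , e , p , q))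

  patLang-++ : (p q : Pattern) → ∀ t → patLang (p ++ q) t ⇔ (patLang p · patLang q) t
  patLang-++ []      q t = ⇔.sym (ε·-identity (patLang q) t)
  patLang-++ (s ∷ p) q t = begin
    (symLang s · patLang (p ++ q)) t              ≈⟨ ·-cong (λ _ → ⇔.refl) (patLang-++ p q) t ⟩
    (symLang s · (patLang p · patLang q)) t       ≈⟨ ·-assoc (symLang s) (patLang p) (patLang q) t ⟨
    ((symLang s · patLang p) · patLang q) t       ∎

  B₁-∅ : BoolClosure E₀ (λ _ → ⊥)
  B₁-∅ = BoolClosure-∅ (base empty)

  symLang-B₁ : (s : Sym) → BoolClosure E₀ (symLang s)
  symLang-B₁ (lit a) = base (letter a)
  symLang-B₁ one     = ext (BoolClosure-Any B₁-∅ (λ a → base (letter a)) (allFin n))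
                           (λ t → mk⇔ satisfied (λ (a , e) → lose (∈-allFin a) e))
  symLang-B₁ many    = ext (compl B₁-∅) (λ _ → mk⇔ (λ _ → tt) (λ _ ()))

  patLang-M₁ : (p : Pattern) → ConcatClosure (BoolClosure E₀) (patLang p)
  patLang-M₁ []      = base (base empty)
  patLang-M₁ (s ∷ p) = concat (base (symLang-B₁ s)) (patLang-M₁ p)

  LIKE⇒B₂ : {L : Lang n} → LIKECharacterizable L → B₂ L
  LIKE⇒B₂ = BoolClosure-bind (λ { (pat p) → base (patLang-M₁ p) })

  data Shape : Set where
    ε-shape      : Shape
    letter-shape : Fin n → Shape
    long-shape   : Shape

  shape : Word → Shape
  shape []          = ε-shape
  shape (a ∷ [])    = letter-shape a
  shape (_ ∷ _ ∷ _) = long-shape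

  _≟ˢ_ : DecidableEquality Shape
  ε-shape        ≟ˢ ε-shape        = yes refl
  letter-shape a ≟ˢ letter-shape b = Dec.map′ (cong letter-shape) (λ { refl → refl }) (a ≟ b)
  long-shape     ≟ˢ long-shape     = yes refl
  ε-shape        ≟ˢ letter-shape _ = no (λ ())
  ε-shape        ≟ˢ long-shape     = no (λ ())
  letter-shape _ ≟ˢ ε-shape        = no (λ ())
  letter-shape _ ≟ˢ long-shape     = no (λ ())
  long-shape     ≟ˢ ε-shape        = no (λ ())
  long-shape     ≟ˢ letter-shape _ = no (λ ())

  allShapes : List Shape
  allShapes = ε-shape ∷ long-shape ∷ map letter-shape (allFin n)

  ∈-allShapes : ∀ s → s ∈ allShapes
  ∈-allShapes ε-shape          = here refl
  ∈-allShapes long-shape       = there (here refl)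
  ∈-allShapes (letter-shape a) = there (there (∈-map⁺ letter-shape (∈-allFin a)))

  shapePattern : Shape → Pattern
  shapePattern ε-shape          = []
  shapePattern (letter-shape a) = lit a ∷ []
  shapePattern long-shape       = one ∷ one ∷ many ∷ []

  matches-shapePattern : ∀ s t → Matches t (shapePattern s) ⇔ shape t ≡ s
  matches-shapePattern s t = mk⇔ (sound s t) (λ { refl → complete t })
    where
    sound : ∀ s t → Matches t (shapePattern s) → shape t ≡ s
    sound ε-shape          t refl                             = refl
    sound (letter-shape a) t (_ , _ , refl , refl , refl)     = refl
    sound long-shape       t (_ , _ , refl , (_ , refl) , _ , _ , refl , (_ , refl) , _ , _ , refl , tt , refl) = refl
    complete : ∀ t → Matches t (shapePattern (shape t))
    complete []          = refl
    complete (a ∷ [])    = a ∷ [] , [] , refl , refl , refl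
    complete (a ∷ b ∷ r) =
      a ∷ [] , b ∷ r , refl , (a , refl) , b ∷ [] , r , refl , (b , refl) , r , [] , sym (++-identityʳ r) , tt , refl

  E₀-singleShape : {L : Lang n} → E₀ L → ∃ λ s → ∀ t → L t ⇔ shape t ≡ s
  E₀-singleShape (letter a) = letter-shape a , λ
    { []          → mk⇔ (λ ()) (λ ())
    ; (_ ∷ [])    → mk⇔ (λ { refl → refl }) (λ { refl → refl })
    ; (_ ∷ _ ∷ _) → mk⇔ (λ ()) (λ ()) }
  E₀-singleShape empty = ε-shape , λ
    { []          → mk⇔ (λ _ → refl) (λ _ → refl)
    ; (_ ∷ [])    → mk⇔ (λ ()) (λ ())
    ; (_ ∷ _ ∷ _) → mk⇔ (λ ()) (λ ()) }

  ShapeDetermined : Lang n → Set₁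
  ShapeDetermined L = ∃ λ (S : Shape → Set) → (∀ s → Dec (S s)) × (∀ t → L t ⇔ S (shape t))

  B₁-shapeDetermined : {L : Lang n} → BoolClosure E₀ L → ShapeDetermined L
  B₁-shapeDetermined (base e) with E₀-singleShape e
  ... | s , L⇔ = (_≡ s) , (_≟ˢ s) , L⇔
  B₁-shapeDetermined (compl b) with B₁-shapeDetermined b
  ... | S , S? , L⇔ = (λ s → ¬ S s) , (λ s → ¬? (S? s)) , (λ t → ¬-cong-⇔ (L⇔ t))
  B₁-shapeDetermined (union a b) with B₁-shapeDetermined a | B₁-shapeDetermined b
  ... | S , S? , L⇔ | R , R? , K⇔ = (λ s → S s ⊎ R s) , (λ s → S? s ⊎-dec R? s) , (λ t → L⇔ t ⊎-⇔ K⇔ t)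
  B₁-shapeDetermined (inter a b) with B₁-shapeDetermined a | B₁-shapeDetermined b
  ... | S , S? , L⇔ | R , R? , K⇔ = (λ s → S s × R s) , (λ s → S? s ×-dec R? s) , (λ t → L⇔ t ×-⇔ K⇔ t)
  B₁-shapeDetermined (ext b e) with B₁-shapeDetermined b
  ... | S , S? , L⇔ = S , S? , (λ t → ⇔.trans (⇔.sym (e t)) (L⇔ t))

  MatchesSome : List Pattern → Lang n
  MatchesSome ps t = Any (Matches t) ps

  PatternUnion : Lang n → Set
  PatternUnion L = ∃ λ ps → ∀ t → L t ⇔ MatchesSome ps t

  matchesSome-shapePatterns : ∀ ss t → shape t ∈ ss ⇔ MatchesSome (map shapePattern ss) t
  matchesSome-shapePatterns ss t =
    ⇔.trans (Any-⇔ (λ s → ⇔.sym (matches-shapePattern s t))) (mk⇔ map⁺ map⁻)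

  shapeDetermined⇒PatternUnion : {L : Lang n} → ShapeDetermined L → PatternUnion L
  shapeDetermined⇒PatternUnion {L} (S , S? , L⇔) = map shapePattern shapes , λ t → begin
    L t                                  ≈⟨ L⇔ t ⟩
    S (shape t)                          ≈⟨ mk⇔ (∈-filter⁺ S? (∈-allShapes (shape t))) (proj₂ ∘ ∈-filter⁻ S?) ⟩
    shape t ∈ shapes                     ≈⟨ matchesSome-shapePatterns shapes t ⟩
    MatchesSome (map shapePattern shapes) t ∎
    where
    shapes : List Shape
    shapes = filter S? allShapes

  matchesSome-· : ∀ ps qs t →
                  MatchesSome (cartesianProductWith _++_ ps qs) t ⇔ (MatchesSome ps · MatchesSome qs) t
  matchesSome-· ps qs t = begin
    MatchesSome (cartesianProductWith _++_ ps qs) t          ≈⟨ Any-cartesianProductWith _++_ ps qs ⟩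
    Any (λ p → Any (λ q → Matches t (p ++ q)) qs) ps         ≈⟨ Any-⇔ (λ p → Any-⇔ (λ q → patLang-++ p q t)) ⟩
    Any (λ p → Any (λ q → (patLang p · patLang q) t) qs) ps  ≈⟨ Any-⇔ (λ p → ·-Anyʳ (patLang p) patLang qs t) ⟩
    Any (λ p → (patLang p · MatchesSome qs) t) ps            ≈⟨ ·-Anyˡ patLang (MatchesSome qs) ps t ⟩
    (MatchesSome ps · MatchesSome qs) t                      ∎

  M₁⇒PatternUnion : {L : Lang n} → ConcatClosure (BoolClosure E₀) L → PatternUnion L
  M₁⇒PatternUnion (base b) = shapeDetermined⇒PatternUnion (B₁-shapeDetermined b)
  M₁⇒PatternUnion (concat a b) with M₁⇒PatternUnion a | M₁⇒PatternUnion b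
  ... | ps , L⇔ | qs , K⇔ =
    cartesianProductWith _++_ ps qs , λ t → ⇔.trans (·-cong L⇔ K⇔ t) (⇔.sym (matchesSome-· ps qs t))
  M₁⇒PatternUnion (ext b e) with M₁⇒PatternUnion b
  ... | ps , L⇔ = ps , λ t → ⇔.trans (⇔.sym (e t)) (L⇔ t)

  matchesSome-LIKE : ∀ ps → LIKECharacterizable (MatchesSome ps)
  matchesSome-LIKE = BoolClosure-Any (BoolClosure-∅ (base (pat []))) (λ p → base (pat p))

  B₂⇒LIKE : {L : Lang n} → B₂ L → LIKECharacterizable L
  B₂⇒LIKE = BoolClosure-bind λ c →
    let ps , L⇔ = M₁⇒PatternUnion c in ext (matchesSome-LIKE ps) (λ t → ⇔.sym (L⇔ t))

mainTheorem1 : (n : ℕ) (L : Lang n) → LIKECharacterizable L ⇔ B₂ L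
mainTheorem1 n L = mk⇔ LIKE⇒B₂ B₂⇒LIKE
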